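{- Let $G$ be a short combinatorial game, and let $H$ be the game obtained from $G$ by removing a dominated option (i.e. removing a Left option $G^{L_1}$ of $G$ for which there is another Left option $G^{L_2}$ with $G^{L_1}\le G^{L_2}$, or removing a Right option $G^{R_1}$ for which there is another Right option $G^{R_2}$ with $G^{R_2}\le G^{R_1}$). Then $G \triangleq H$.
   Context: Games are short normal-play combinatorial games, written $G\cong\{L(G)\mid R(G)\}$, where $\cong$ denotes identity of literal forms and $L(G)$, $R(G)$ are the sets of Left and Right options. The disjunctive sum is $G+H\cong\{G^L+H,\,G+H^L\mid G^R+H,\,G+H^R\}$, negation is $-G\cong\{ -R(G)\mid -L(G)\}$, $G-H$ means $G+(-H)$, $G\le H$ iff Left wins $H-G$... equivalently, Left wins $G-H$ moving second iff $G\ge H$; $G=H$ iff $G\le H$ and $H\le G$. Two games $G,H$ are equivalent modulo domination, written $G\triangleq H$, if in the sum $G+(-H)$, for every first move by either player in either summand, the other player has a winning response (as second player) made in the other summand. -}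

module Defs where

open import Data.List using (List; []; _∷_; _++_; length; lookup; removeAt)
open import Data.List.Membership.Propositional using (_∈_)
open import Data.Fin using (Fin)
open import Data.Product using (Σ; ∃; _×_; _,_)
open import Relation.Binary.PropositionalEquality using (_≡_; _≢_)

-- Short games: finite trees whose nodes carry a (finite) list of Left
-- options and a list of Right options.  ⟨ L ∣ R ⟩ is the literal form {L | R}.
data Game : Set where
  ⟨_∣_⟩ : List Game → List Game → Game

LeftOpts : Game → List Game
LeftOpts ⟨ L ∣ R ⟩ = L

RightOpts : Game → List Game
RightOpts ⟨ L ∣ R ⟩ = R

mutual
  -_ : Game → Game
  - ⟨ L ∣ R ⟩ = ⟨ negs R ∣ negs L ⟩

  negs : List Game → List Game
  negs []       = []
  negs (x ∷ xs) = (- x) ∷ negs xs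

mutual
  infixl 6 _+_
  _+_ : Game → Game → Game
  ⟨ GL ∣ GR ⟩ + ⟨ HL ∣ HR ⟩ =
    ⟨ addˡ GL ⟨ HL ∣ HR ⟩ ++ addʳ ⟨ GL ∣ GR ⟩ HL
    ∣ addˡ GR ⟨ HL ∣ HR ⟩ ++ addʳ ⟨ GL ∣ GR ⟩ HR ⟩

  addˡ : List Game → Game → List Game
  addˡ []       H = []
  addˡ (x ∷ xs) H = (x + H) ∷ addˡ xs H

  addʳ : Game → List Game → List Game
  addʳ G []       = []
  addʳ G (y ∷ ys) = (G + y) ∷ addʳ G ys

infixl 6 _-_
_-_ : Game → Game → Game
G - H = G + (- H)

-- Normal play winning (inductively: existence of a winning strategy).
-- LWin₂ G : Left wins G moving second (Right starts);
-- LWin₁ G : Left wins G moving first.  Similarly for Right.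
mutual
  data LWin₂ : Game → Set where
    lw₂ : ∀ {L R} → (∀ {X} → X ∈ R → LWin₁ X) → LWin₂ ⟨ L ∣ R ⟩

  data LWin₁ : Game → Set where
    lw₁ : ∀ {L R X} → X ∈ L → LWin₂ X → LWin₁ ⟨ L ∣ R ⟩

mutual
  data RWin₂ : Game → Set where
    rw₂ : ∀ {L R} → (∀ {X} → X ∈ L → RWin₁ X) → RWin₂ ⟨ L ∣ R ⟩

  data RWin₁ : Game → Set where
    rw₁ : ∀ {L R X} → X ∈ R → RWin₂ X → RWin₁ ⟨ L ∣ R ⟩

infix 4 _≥ᵍ_ _≤ᵍ_
_≥ᵍ_ : Game → Game → Set
G ≥ᵍ H = LWin₂ (G - H)

_≤ᵍ_ : Game → Game → Set
G ≤ᵍ H = H ≥ᵍ G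

-- Equivalence modulo domination, G ≜ H: in G + (-H), every first move by
-- either player in either summand has a winning reply (the replier then
-- wins as second player) by the other player in the other summand.
infix 4 _≜_
_≜_ : Game → Game → Set
G ≜ H =
    (∀ {X} → X ∈ LeftOpts G → ∃ λ Y → Y ∈ RightOpts (- H) × RWin₂ (X + Y))
  × (∀ {Y} → Y ∈ LeftOpts (- H) → ∃ λ X → X ∈ RightOpts G × RWin₂ (X + Y))
  × (∀ {X} → X ∈ RightOpts G → ∃ λ Y → Y ∈ LeftOpts (- H) × LWin₂ (X + Y))
  × (∀ {Y} → Y ∈ RightOpts (- H) → ∃ λ X → X ∈ LeftOpts G × LWin₂ (X + Y))

data RemovesDominated : Game → Game → Set where
  dropLeft  : ∀ L R (i j : Fin (length L)) → i ≢ j →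
              lookup L i ≤ᵍ lookup L j →
              RemovesDominated ⟨ L ∣ R ⟩ ⟨ removeAt L i ∣ R ⟩
  dropRight : ∀ L R (i j : Fin (length R)) → i ≢ j →
              lookup R j ≤ᵍ lookup R i →
              RemovesDominated ⟨ L ∣ R ⟩ ⟨ L ∣ removeAt R i ⟩

{-# OPTIONS --safe #-}
-- Proof idea: X - X is a second-player win for every X (mirror strategy),
-- and the options of H are among those of G.  So every move in one summand
-- of G - H is answered by its mirror image in the other, except a move to
-- the removed option of G; that one is answered by the mirror image of the
-- option dominating it, which wins for the replier precisely by the
-- domination inequality.
module Submission where

open import Defs
open import Data.List using (List; []; _∷_; map; lookup; removeAt)
open import Data.List.Membership.Propositional using (_∈_)
open import Data.List.Membership.Propositional.Properties
  using (∈-++⁺ˡ; ∈-++⁺ʳ; ∈-++⁻; ∈-map⁺; ∈-map⁻; ∈-lookup)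
open import Data.List.Relation.Binary.Subset.Propositional using (_⊆_)
open import Data.List.Relation.Unary.Any using (here; there)
open import Data.Fin using (zero; suc)
open import Data.Product using (∃; _×_; _,_)
open import Data.Sum using (_⊎_; inj₁; inj₂)
open import Data.Empty using (⊥-elim)
open import Relation.Binary.PropositionalEquality
  using (_≡_; _≢_; refl; sym; cong; subst)
open import Function using (_∘_; id)

negs≡map : ∀ xs → negs xs ≡ map -_ xs
negs≡map []       = refl
negs≡map (x ∷ xs) = cong (- x ∷_) (negs≡map xs)

addˡ≡map : ∀ xs H → addˡ xs H ≡ map (_+ H) xs
addˡ≡map []       H = refl
addˡ≡map (x ∷ xs) H = cong (x + H ∷_) (addˡ≡map xs H)

addʳ≡map : ∀ G ys → addʳ G ys ≡ map (G +_) ys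
addʳ≡map G []       = refl
addʳ≡map G (y ∷ ys) = cong (G + y ∷_) (addʳ≡map G ys)

∈-negs⁺ : ∀ {X xs} → X ∈ xs → - X ∈ negs xs
∈-negs⁺ {xs = xs} p = subst (_ ∈_) (sym (negs≡map xs)) (∈-map⁺ -_ p)

∈-negs⁻ : ∀ {Z} xs → Z ∈ negs xs → ∃ λ X → X ∈ xs × Z ≡ - X
∈-negs⁻ xs p = ∈-map⁻ -_ (subst (_ ∈_) (negs≡map xs) p)

∈-addˡ⁺ : ∀ {X xs} H → X ∈ xs → X + H ∈ addˡ xs H
∈-addˡ⁺ {xs = xs} H p = subst (_ ∈_) (sym (addˡ≡map xs H)) (∈-map⁺ (_+ H) p)

∈-addˡ⁻ : ∀ {Z} xs H → Z ∈ addˡ xs H → ∃ λ X → X ∈ xs × Z ≡ X + H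
∈-addˡ⁻ xs H p = ∈-map⁻ (_+ H) (subst (_ ∈_) (addˡ≡map xs H) p)

∈-addʳ⁺ : ∀ {Y ys} G → Y ∈ ys → G + Y ∈ addʳ G ys
∈-addʳ⁺ {ys = ys} G p = subst (_ ∈_) (sym (addʳ≡map G ys)) (∈-map⁺ (G +_) p)

∈-addʳ⁻ : ∀ {Z} G ys → Z ∈ addʳ G ys → ∃ λ Y → Y ∈ ys × Z ≡ G + Y
∈-addʳ⁻ G ys p = ∈-map⁻ (G +_) (subst (_ ∈_) (addʳ≡map G ys) p)

+-leftOptˡ : ∀ G H {X} → X ∈ LeftOpts G → X + H ∈ LeftOpts (G + H)
+-leftOptˡ ⟨ GL ∣ GR ⟩ ⟨ HL ∣ HR ⟩ p = ∈-++⁺ˡ (∈-addˡ⁺ _ p)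

+-leftOptʳ : ∀ G H {Y} → Y ∈ LeftOpts H → G + Y ∈ LeftOpts (G + H)
+-leftOptʳ ⟨ GL ∣ GR ⟩ ⟨ HL ∣ HR ⟩ p = ∈-++⁺ʳ (addˡ GL _) (∈-addʳ⁺ _ p)

+-rightOptˡ : ∀ G H {X} → X ∈ RightOpts G → X + H ∈ RightOpts (G + H)
+-rightOptˡ ⟨ GL ∣ GR ⟩ ⟨ HL ∣ HR ⟩ p = ∈-++⁺ˡ (∈-addˡ⁺ _ p)

+-rightOptʳ : ∀ G H {Y} → Y ∈ RightOpts H → G + Y ∈ RightOpts (G + H)
+-rightOptʳ ⟨ GL ∣ GR ⟩ ⟨ HL ∣ HR ⟩ p = ∈-++⁺ʳ (addˡ GR _) (∈-addʳ⁺ _ p)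

+-leftOpt⁻ : ∀ G H {Z} → Z ∈ LeftOpts (G + H) →
  (∃ λ X → X ∈ LeftOpts G × Z ≡ X + H) ⊎ (∃ λ Y → Y ∈ LeftOpts H × Z ≡ G + Y)
+-leftOpt⁻ ⟨ GL ∣ GR ⟩ ⟨ HL ∣ HR ⟩ p with ∈-++⁻ (addˡ GL _) p
... | inj₁ q = inj₁ (∈-addˡ⁻ GL _ q)
... | inj₂ q = inj₂ (∈-addʳ⁻ _ HL q)

+-rightOpt⁻ : ∀ G H {Z} → Z ∈ RightOpts (G + H) →
  (∃ λ X → X ∈ RightOpts G × Z ≡ X + H) ⊎ (∃ λ Y → Y ∈ RightOpts H × Z ≡ G + Y)
+-rightOpt⁻ ⟨ GL ∣ GR ⟩ ⟨ HL ∣ HR ⟩ p with ∈-++⁻ (addˡ GR _) p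
... | inj₁ q = inj₁ (∈-addˡ⁻ GR _ q)
... | inj₂ q = inj₂ (∈-addʳ⁻ _ HR q)

-‿leftOpt : ∀ G {X} → X ∈ RightOpts G → - X ∈ LeftOpts (- G)
-‿leftOpt ⟨ L ∣ R ⟩ = ∈-negs⁺

-‿rightOpt : ∀ G {X} → X ∈ LeftOpts G → - X ∈ RightOpts (- G)
-‿rightOpt ⟨ L ∣ R ⟩ = ∈-negs⁺

-‿leftOpt⁻ : ∀ G {Z} → Z ∈ LeftOpts (- G) → ∃ λ X → X ∈ RightOpts G × Z ≡ - X
-‿leftOpt⁻ ⟨ L ∣ R ⟩ = ∈-negs⁻ R

-‿rightOpt⁻ : ∀ G {Z} → Z ∈ RightOpts (- G) → ∃ λ X → X ∈ LeftOpts G × Z ≡ - X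
-‿rightOpt⁻ ⟨ L ∣ R ⟩ = ∈-negs⁻ L

LWin₁-intro : ∀ G {X} → X ∈ LeftOpts G → LWin₂ X → LWin₁ G
LWin₁-intro ⟨ L ∣ R ⟩ = lw₁

RWin₁-intro : ∀ G {X} → X ∈ RightOpts G → RWin₂ X → RWin₁ G
RWin₁-intro ⟨ L ∣ R ⟩ = rw₁

mutual
  ≥ᵍ-refl : ∀ G → G ≥ᵍ G
  ≥ᵍ-refl G@(⟨ L ∣ R ⟩) = lw₂ mirrorReply
    where
    mirrorReply : ∀ {Z} → Z ∈ RightOpts (G - G) → LWin₁ Z
    mirrorReply p with +-rightOpt⁻ G (- G) p
    ... | inj₁ (X , x , refl) =
      LWin₁-intro (X - G) (+-leftOptʳ X (- G) (-‿leftOpt G x)) (≥ᵍ-refl-∈ R x)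
    ... | inj₂ (Y , y , refl) with -‿rightOpt⁻ G y
    ... | X , x , refl = LWin₁-intro (G - X) (+-leftOptˡ G (- X) x) (≥ᵍ-refl-∈ L x)

  ≥ᵍ-refl-∈ : ∀ xs {X} → X ∈ xs → X ≥ᵍ X
  ≥ᵍ-refl-∈ (x ∷ xs) (here refl) = ≥ᵍ-refl x
  ≥ᵍ-refl-∈ (x ∷ xs) (there p)   = ≥ᵍ-refl-∈ xs p

-- Right copies, in B - A, the strategy with which Left wins A - B.
mutual
  ≥ᵍ⇒RWin₂ : ∀ A B → A ≥ᵍ B → RWin₂ (B - A)
  ≥ᵍ⇒RWin₂ A@(⟨ AL ∣ AR ⟩) B@(⟨ BL ∣ BR ⟩) (lw₂ leftWins) = rw₂ rightWins
    where
    rightWins : ∀ {Z} → Z ∈ LeftOpts (B - A) → RWin₁ Z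
    rightWins p with +-leftOpt⁻ B (- A) p
    ... | inj₁ (X , x , refl) = LWin₁⇒RWin₁ A X (leftWins (+-rightOptʳ A (- B) (-‿rightOpt B x)))
    ... | inj₂ (Y , y , refl) with -‿leftOpt⁻ A y
    ... | X , x , refl = LWin₁⇒RWin₁ X B (leftWins (+-rightOptˡ A (- B) x))

  LWin₁⇒RWin₁ : ∀ A B → LWin₁ (A - B) → RWin₁ (B - A)
  LWin₁⇒RWin₁ A@(⟨ AL ∣ AR ⟩) B@(⟨ BL ∣ BR ⟩) (lw₁ p w) with +-leftOpt⁻ A (- B) p
  ... | inj₁ (X , x , refl) = RWin₁-intro (B - A) (+-rightOptʳ B (- A) (-‿rightOpt A x)) (≥ᵍ⇒RWin₂ X B w)
  ... | inj₂ (Y , y , refl) with -‿leftOpt⁻ B y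
  ... | X , x , refl = RWin₁-intro (B - A) (+-rightOptˡ B (- A) x) (≥ᵍ⇒RWin₂ A X w)

infix 4 _≼ᴸ_ _≼ᴿ_
_≼ᴸ_ : List Game → List Game → Set
xs ≼ᴸ ys = ∀ {X} → X ∈ xs → ∃ λ Y → Y ∈ ys × X ≤ᵍ Y

_≼ᴿ_ : List Game → List Game → Set
xs ≼ᴿ ys = ∀ {X} → X ∈ xs → ∃ λ Y → Y ∈ ys × Y ≤ᵍ X

≼ᴸ-refl : ∀ xs → xs ≼ᴸ xs
≼ᴸ-refl xs {X} p = X , p , ≥ᵍ-refl X

≼ᴿ-refl : ∀ xs → xs ≼ᴿ xs
≼ᴿ-refl xs {X} p = X , p , ≥ᵍ-refl X

≜-intro : ∀ {GL GR HL HR} → HL ⊆ GL → HR ⊆ GR → GL ≼ᴸ HL → GR ≼ᴿ HR →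
          ⟨ GL ∣ GR ⟩ ≜ ⟨ HL ∣ HR ⟩
≜-intro {GL} {GR} {HL} {HR} HL⊆GL HR⊆GR GL≼HL GR≼HR =
  leftInG , leftInH , rightInG , rightInH
  where
  leftInG : ∀ {X} → X ∈ GL → ∃ λ Y → Y ∈ negs HL × RWin₂ (X + Y)
  leftInG p with GL≼HL p
  ... | Y , y , X≤Y = - Y , ∈-negs⁺ y , ≥ᵍ⇒RWin₂ Y _ X≤Y
  leftInH : ∀ {Y} → Y ∈ negs HR → ∃ λ X → X ∈ GR × RWin₂ (X + Y)
  leftInH p with ∈-negs⁻ HR p
  ... | X , x , refl = X , HR⊆GR x , ≥ᵍ⇒RWin₂ X X (≥ᵍ-refl X)
  rightInG : ∀ {X} → X ∈ GR → ∃ λ Y → Y ∈ negs HR × LWin₂ (X + Y)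
  rightInG p with GR≼HR p
  ... | Y , y , Y≤X = - Y , ∈-negs⁺ y , Y≤X
  rightInH : ∀ {Y} → Y ∈ negs HL → ∃ λ X → X ∈ GL × LWin₂ (X + Y)
  rightInH p with ∈-negs⁻ HL p
  ... | X , x , refl = X , HL⊆GL x , ≥ᵍ-refl X

module _ {A : Set} where

  ∈-removeAt⁻ : ∀ {x} (xs : List A) i → x ∈ removeAt xs i → x ∈ xs
  ∈-removeAt⁻ (y ∷ xs) zero    p         = there p
  ∈-removeAt⁻ (y ∷ xs) (suc i) (here e)  = here e
  ∈-removeAt⁻ (y ∷ xs) (suc i) (there p) = there (∈-removeAt⁻ xs i p)

  ∈-removeAt⁺ : ∀ (xs : List A) {i j} → i ≢ j → lookup xs j ∈ removeAt xs i
  ∈-removeAt⁺ (x ∷ xs) {zero}  {zero}  i≢j = ⊥-elim (i≢j refl)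
  ∈-removeAt⁺ (x ∷ xs) {zero}  {suc j} i≢j = ∈-lookup j
  ∈-removeAt⁺ (x ∷ xs) {suc i} {zero}  i≢j = here refl
  ∈-removeAt⁺ (x ∷ xs) {suc i} {suc j} i≢j = there (∈-removeAt⁺ xs (i≢j ∘ cong suc))

  ∈⇒≡lookup⊎∈-removeAt : ∀ {x} (xs : List A) i → x ∈ xs → x ≡ lookup xs i ⊎ x ∈ removeAt xs i
  ∈⇒≡lookup⊎∈-removeAt (y ∷ xs) zero    (here e)  = inj₁ e
  ∈⇒≡lookup⊎∈-removeAt (y ∷ xs) zero    (there p) = inj₂ p
  ∈⇒≡lookup⊎∈-removeAt (y ∷ xs) (suc i) (here e)  = inj₂ (here e)
  ∈⇒≡lookup⊎∈-removeAt (y ∷ xs) (suc i) (there p) with ∈⇒≡lookup⊎∈-removeAt xs i p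
  ... | inj₁ e = inj₁ e
  ... | inj₂ q = inj₂ (there q)

removeAt-≼ᴸ : ∀ xs {i j} → i ≢ j → lookup xs i ≤ᵍ lookup xs j → xs ≼ᴸ removeAt xs i
removeAt-≼ᴸ xs {i} {j} i≢j dominated p with ∈⇒≡lookup⊎∈-removeAt xs i p
... | inj₁ refl = lookup xs j , ∈-removeAt⁺ xs i≢j , dominated
... | inj₂ q    = ≼ᴸ-refl _ q

removeAt-≼ᴿ : ∀ xs {i j} → i ≢ j → lookup xs j ≤ᵍ lookup xs i → xs ≼ᴿ removeAt xs i
removeAt-≼ᴿ xs {i} {j} i≢j dominated p with ∈⇒≡lookup⊎∈-removeAt xs i p
... | inj₁ refl = lookup xs j , ∈-removeAt⁺ xs i≢j , dominated
... | inj₂ q    = ≼ᴿ-refl _ q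

lemma2p1 : (G H : Game) → RemovesDominated G H → G ≜ H
lemma2p1 _ _ (dropLeft L R i j i≢j dominated) =
  ≜-intro (∈-removeAt⁻ L i) id (removeAt-≼ᴸ L i≢j dominated) (≼ᴿ-refl R)
lemma2p1 _ _ (dropRight L R i j i≢j dominated) =
  ≜-intro id (∈-removeAt⁻ R i) (≼ᴸ-refl L) (removeAt-≼ᴿ R i≢j dominated)
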